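{- Let $n_0\in\mathbb{N}$ and, for $i\in\mathbb{N}$, let $n_i=3n_{i-1}+d_i$ with $d_i\in\{1,2,3\}$. Then there is a $1$-clique configuration of $K_{n_i}$ whose total number of brushes $S_{n_i}$ satisfies $$S_{n_i}\le\Big[\frac{3}{7}+\frac{1}{63}\Big(\frac{2}{9}\Big)^{i}\Big]n_i^2+O(n_i).$$
   Context: $K_n$ is the complete graph on $n$ vertices. Parallel cleaning process on a graph $G=(V,E)$ with initial configuration $\omega_0:V\to\mathbb{N}\cup\{0\}$: $D_0=V$, $t=0$; $D_t(v)=|N(v)\cap D_t|$ if $v\in D_t$, else $0$; $\rho_{t+1}=\{v\in D_t:\omega_t(v)\ge D_t(v)\}$; if $\rho_{t+1}=\emptyset$ stop with $K=t$, final dirty set $D_K$ and final configuration $\omega_K$; otherwise $D_{t+1}=D_t\setminus\rho_{t+1}$, $\omega_{t+1}(v)=\omega_t(v)-D_t(v)+|N(v)\cap\rho_{t+1}|$ for $v\in\rho_{t+1}$, $\omega_{t+1}(u)=\omega_t(u)+|N(u)\cap\rho_{t+1}|$ for $u\in D_{t+1}$, other values unchanged, and repeat with $t+1$. $\omega_0$ cleans $G$ if $D_K=\emptyset$. A $1$-clique configuration of $K_n$ (vertices $v_0,\dots,v_{n-1}$) is an initial configuration $\omega_0$ that cleans $K_n$ with final configuration $\omega_K$ such that (1) $\omega_0(v_i)\le n-1$ for all $i$, and (2) there is a one-to-one correspondence between the elements of $\{\omega_0(v_0),\dots,\omega_0(v_{n-1})\}$ and $\{\omega_K(v_0),\dots,\omega_K(v_{n-1})\}$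 (i.e. $\omega_K$ is obtained from $\omega_0$ by relabeling the vertices). For a $1$-clique configuration $\omega_0$ of $K_n$, $S_n=\sum_i\omega_0(v_i)$ is its total number of brushes. -}

module Defs where

open import Data.Nat using (ℕ; zero; suc; _+_; _*_; _∸_; _≤ᵇ_)
open import Data.Bool using (Bool; true; false; _∧_; not; if_then_else_)
open import Data.Fin using (Fin; zero; suc; _≟_)
open import Data.Fin.Permutation using (Permutation′; _⟨$⟩ʳ_)
open import Data.Product using (_×_; Σ; _,_; proj₁; proj₂)
open import Relation.Nullary.Decidable using (⌊_⌋)
open import Relation.Binary.PropositionalEquality using (_≡_)
open import Function using (_∘_)

Graph : ℕ → Set
Graph n = Fin n → Fin n → Bool

complete : (n : ℕ) → Graph n
complete n i j = not ⌊ i ≟ j ⌋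

countF : ∀ {n} → (Fin n → Bool) → ℕ
countF {zero} P = 0
countF {suc n} P = (if P zero then 1 else 0) + countF (P ∘ suc)

sumF : ∀ {n} → (Fin n → ℕ) → ℕ
sumF {zero} f = 0
sumF {suc n} f = f zero + sumF (f ∘ suc)

Config : ℕ → Set
Config n = Fin n → ℕ

DirtySet : ℕ → Set
DirtySet n = Fin n → Bool

module Cleaning {n : ℕ} (G : Graph n) where

  degD : DirtySet n → Fin n → ℕ
  degD D v = if D v then countF (λ u → G v u ∧ D u) else 0

  rho : DirtySet n → Config n → Fin n → Bool
  rho D ω v = D v ∧ (degD D v ≤ᵇ ω v)

  -- one step of the parallel cleaning process; when ρ is empty the step is
  -- the identity (the process has stopped).
  step : DirtySet n × Config n → DirtySet n × Config n
  step (D , ω) = D′ , ω′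
    where
    ρ : Fin n → Bool
    ρ = rho D ω
    nρ : Fin n → ℕ
    nρ v = countF (λ u → G v u ∧ ρ u)
    D′ : DirtySet n
    D′ v = D v ∧ not (ρ v)
    ω′ : Config n
    ω′ v = if ρ v then ω v ∸ degD D v + nρ v
           else (if D v then ω v + nρ v else ω v)

  iter : ℕ → DirtySet n × Config n → DirtySet n × Config n
  iter zero s = s
  iter (suc k) s = iter k (step s)

  -- Each non-stopping step removes at least one dirty vertex, so after n
  -- iterations the process has reached its final state (D_K , ω_K).
  final : Config n → DirtySet n × Config n
  final ω₀ = iter n ((λ _ → true) , ω₀)

  finalDirty : Config n → DirtySet n
  finalDirty ω₀ = proj₁ (final ω₀)

  finalConfig : Config n → Config n
  finalConfig ω₀ = proj₂ (final ω₀)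

  Cleans : Config n → Set
  Cleans ω₀ = ∀ v → finalDirty ω₀ v ≡ false

OneClique : (n : ℕ) → Config n → Set
OneClique n ω₀ =
  Cleans ω₀ ×
  (∀ v → ω₀ v Data.Nat.≤ n ∸ 1) ×
  Σ (Permutation′ n) (λ π → ∀ v → finalConfig ω₀ (π ⟨$⟩ʳ v) ≡ ω₀ v)
  where open Cleaning (complete n)

brushes : ∀ {n} → Config n → ℕ
brushes = sumF

nSeq : ℕ → (ℕ → ℕ) → ℕ → ℕ
nSeq n₀ d zero = n₀
nSeq n₀ d (suc i) = 3 * nSeq n₀ d i + d (suc i)

-- With N = n_i and M = N + d_{i+1}, the clique K_{N+M+N} is split
-- into a high copy of the level-i configuration with N + M extra brushes per vertex, a middle clique
-- of M vertices with M - 1 brushes each, and a low copy of the level-i configuration. The extra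
-- brushes of the high copy exactly compensate its N + M extra dirty neighbours, so it is cleaned by
-- the level-i schedule in rounds 0, ..., 2i; then the middle block fires in round 2i + 1 and the low
-- copy, which has meanwhile received N + M brushes, in round 2i + 2. In the final configuration the
-- high copy carries the level-i final values, the middle block is unchanged and the low copy carries
-- the initial values of the high copy, so the final configuration is a relabelling of the initial
-- one. The totals satisfy S' = 2S + M(M - 1) + N(N + M), and since d_{i+1} ≤ 3 this keeps
-- 7 S ≤ 3 n² + 7 C n, which is stronger than the claimed bound.

module Submission where

open import Defs
open import Data.Bool using (Bool; true; false; _∧_; not; if_then_else_)
open import Data.Bool.Properties using (∧-zeroʳ)
open import Data.Fin using (Fin; zero; suc; _≟_; cast; splitAt)
open import Data.Fin.Permutation using (Permutation′; _⟨$⟩ʳ_; cast-id)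
open import Data.Fin.Properties using (+↔⊎)
open import Data.Nat using (ℕ; zero; suc; _+_; _*_; _∸_; _^_; _≤_; _<_; _≤ᵇ_; _≤?_; z≤n; s≤s)
open import Data.Nat.Properties hiding (_≟_)
open import Data.Nat.Tactic.RingSolver using (solve-∀)
open import Data.Product using (_×_; Σ; ∃; _,_; proj₁; proj₂)
open import Data.Sum as Sum using (_⊎_; inj₁; inj₂)
open import Data.Sum.Function.Propositional using (_⊎-↔_)
open import Algebra.Properties.CommutativeSemigroup +-commutativeSemigroup using (interchange)
open import Function using (_∘_; id; _↔_; Inverse; mk↔ₛ′)
open import Function.Properties.Inverse using (↔-refl; ↔-sym; ↔-trans)
open import Relation.Binary using (tri<; tri≈; tri>)
open import Relation.Binary.PropositionalEquality
open import Relation.Nullary using (yes; no)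
open import Relation.Nullary.Decidable using (⌊⌋-map′; dec-true; dec-false)

≤ᵇ-true : ∀ {m n} → m ≤ n → (m ≤ᵇ n) ≡ true
≤ᵇ-true {m} {n} = dec-true (m ≤? n)

≤ᵇ-false : ∀ {m n} → n < m → (m ≤ᵇ n) ≡ false
≤ᵇ-false {m} {n} n<m = dec-false (m ≤? n) (<⇒≱ n<m)

indicator : Bool → ℕ
indicator b = if b then 1 else 0

sumF-cong : ∀ {n} {f g : Fin n → ℕ} → (∀ u → f u ≡ g u) → sumF f ≡ sumF g
sumF-cong {zero}  _   = refl
sumF-cong {suc n} f≗g = cong₂ _+_ (f≗g zero) (sumF-cong (f≗g ∘ suc))

sumF-const : ∀ n a → sumF {n} (λ _ → a) ≡ n * a
sumF-const zero    a = refl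
sumF-const (suc n) a = cong (a +_) (sumF-const n a)

sumF-+ : ∀ {n} (f g : Fin n → ℕ) → sumF (λ u → f u + g u) ≡ sumF f + sumF g
sumF-+ {zero}  f g = refl
sumF-+ {suc n} f g = trans (cong (f zero + g zero +_) (sumF-+ (f ∘ suc) (g ∘ suc)))
                           (interchange (f zero) (g zero) (sumF (f ∘ suc)) (sumF (g ∘ suc)))

sumF-cast : ∀ {m n} (eq : m ≡ n) (f : Fin n → ℕ) → sumF (f ∘ cast eq) ≡ sumF f
sumF-cast {zero}  {zero}  eq f = refl
sumF-cast {suc m} {suc n} eq f = cong (f zero +_) (sumF-cast {m} {n} (suc-injective eq) (f ∘ suc))

sumF-splitAt : ∀ m {n} (f : Fin m ⊎ Fin n → ℕ) →
               sumF (f ∘ splitAt m) ≡ sumF (f ∘ inj₁) + sumF (f ∘ inj₂)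
sumF-splitAt zero    f = refl
sumF-splitAt (suc m) {n} f = trans (cong (f (inj₁ zero) +_) (sumF-splitAt m {n} (f ∘ Sum.map₁ suc)))
                               (sym (+-assoc (f (inj₁ zero)) _ _))

countF-sumF : ∀ {n} (P : Fin n → Bool) → countF P ≡ sumF (indicator ∘ P)
countF-sumF {zero}  P = refl
countF-sumF {suc n} P = cong (indicator (P zero) +_) (countF-sumF (P ∘ suc))

countF-cong : ∀ {n} {P Q : Fin n → Bool} → (∀ u → P u ≡ Q u) → countF P ≡ countF Q
countF-cong {zero}  _   = refl
countF-cong {suc n} P≗Q = cong₂ _+_ (cong indicator (P≗Q zero)) (countF-cong (P≗Q ∘ suc))

countF-≤ : ∀ {n} (P : Fin n → Bool) → countF P ≤ n
countF-≤ {zero}  P = z≤n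
countF-≤ {suc n} P with P zero
... | true  = s≤s (countF-≤ (P ∘ suc))
... | false = m≤n⇒m≤1+n (countF-≤ (P ∘ suc))

countF-true : ∀ n → countF {n} (λ _ → true) ≡ n
countF-true n = trans (countF-sumF {n} (λ _ → true)) (trans (sumF-const n 1) (*-identityʳ n))

countF-split : ∀ {n} (P Q : Fin n → Bool) →
               countF P ≡ countF (λ u → P u ∧ Q u) + countF (λ u → P u ∧ not (Q u))
countF-split {zero}  P Q = refl
countF-split {suc n} P Q with P zero | Q zero | countF-split (P ∘ suc) (Q ∘ suc)
... | true  | true  | ih = cong suc ih
... | true  | false | ih = trans (cong suc ih) (sym (+-suc _ _))
... | false | _     | ih = ih

complete-suc : ∀ {n} (v u : Fin n) → complete (suc n) (suc v) (suc u) ≡ complete n v u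
complete-suc v u = cong not (⌊⌋-map′ _ _ (v ≟ u))

countF-others : ∀ {n} (P : Fin n → Bool) v →
                countF (λ u → complete n v u ∧ P u) + indicator (P v) ≡ countF P
countF-others {suc n} P zero    = +-comm (countF (P ∘ suc)) (indicator (P zero))
countF-others {suc n} P (suc v) = begin
  indicator (P zero) + countF (λ u → complete (suc n) (suc v) (suc u) ∧ P (suc u)) + indicator (P (suc v))
    ≡⟨ cong (λ k → indicator (P zero) + k + indicator (P (suc v)))
            (countF-cong (λ u → cong (_∧ P (suc u)) (complete-suc v u))) ⟩
  indicator (P zero) + countF (λ u → complete n v u ∧ P (suc u)) + indicator (P (suc v))
    ≡⟨ +-assoc (indicator (P zero)) _ _ ⟩
  indicator (P zero) + (countF (λ u → complete n v u ∧ P (suc u)) + indicator (P (suc v)))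
    ≡⟨ cong (indicator (P zero) +_) (countF-others (P ∘ suc) v) ⟩
  indicator (P zero) + countF (P ∘ suc) ∎
  where open ≡-Reasoning

countF-others-true : ∀ {n} (P : Fin n → Bool) v → P v ≡ true →
                     countF (λ u → complete n v u ∧ P u) ≡ countF P ∸ 1
countF-others-true P v Pv = begin
  others                          ≡⟨ m+n∸n≡m others 1 ⟨
  others + indicator true ∸ 1     ≡⟨ cong (λ b → others + indicator b ∸ 1) Pv ⟨
  others + indicator (P v) ∸ 1    ≡⟨ cong (_∸ 1) (countF-others P v) ⟩
  countF P ∸ 1                    ∎
  where
  open ≡-Reasoning
  others : ℕ
  others = countF (λ u → complete _ v u ∧ P u)

∸-+-∸ : ∀ {n c c′} → c′ ≤ c → c ≤ n → (n ∸ c) + (c ∸ c′) ≡ n ∸ c′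
∸-+-∸ {n} {c} {c′} c′≤c c≤n = trans (sym (+-∸-assoc (n ∸ c) c′≤c)) (cong (_∸ c′) (m∸n+n≡m c≤n))

_≋_ : ∀ {n} → DirtySet n × Config n → DirtySet n × Config n → Set
(D , ω) ≋ (D′ , ω′) = ∀ v → D v ≡ D′ v × ω v ≡ ω′ v

≋-trans : ∀ {n} {s s′ s″ : DirtySet n × Config n} → s ≋ s′ → s′ ≋ s″ → s ≋ s″
≋-trans s≋s′ s′≋s″ v = trans (proj₁ (s≋s′ v)) (proj₁ (s′≋s″ v)) ,
                       trans (proj₂ (s≋s′ v)) (proj₂ (s′≋s″ v))

module CleaningSteps {n : ℕ} (G : Graph n) where
  open Cleaning G

  received : DirtySet n → Config n → Fin n → ℕ
  received D ω v = countF (λ u → G v u ∧ rho D ω u)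

  private
    stepValue : Bool → Bool → ℕ → ℕ → ℕ → ℕ
    stepValue fired dirty w deg recv = if fired then w ∸ deg + recv else (if dirty then w + recv else w)

    stepValue-cong : ∀ {a a′ b b′ w w′ x x′ y y′} → a ≡ a′ → b ≡ b′ → w ≡ w′ → x ≡ x′ → y ≡ y′ →
                     stepValue a b w x y ≡ stepValue a′ b′ w′ x′ y′
    stepValue-cong refl refl refl refl refl = refl

  step-cong : ∀ {s s′} → s ≋ s′ → step s ≋ step s′
  step-cong {D , ω} {D′ , ω′} s≋s′ v =
    cong₂ (λ a b → a ∧ not b) (D≗ v) (rho≗ v) ,
    stepValue-cong (rho≗ v) (D≗ v) (ω≗ v) (degD≗ v) (countF-cong (λ u → cong (G v u ∧_) (rho≗ u)))
    where
    D≗ : ∀ u → D u ≡ D′ u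
    D≗ u = proj₁ (s≋s′ u)
    ω≗ : ∀ u → ω u ≡ ω′ u
    ω≗ u = proj₂ (s≋s′ u)
    degD≗ : ∀ u → degD D u ≡ degD D′ u
    degD≗ u = cong₂ (λ b k → if b then k else 0) (D≗ u) (countF-cong (λ x → cong (G u x ∧_) (D≗ x)))
    rho≗ : ∀ u → rho D ω u ≡ rho D′ ω′ u
    rho≗ u = cong₂ _∧_ (D≗ u) (cong₂ _≤ᵇ_ (degD≗ u) (ω≗ u))

  iter-cong : ∀ k {s s′} → s ≋ s′ → iter k s ≋ iter k s′
  iter-cong zero    s≋s′ = s≋s′
  iter-cong (suc k) s≋s′ = iter-cong k (step-cong s≋s′)

  step-fired : ∀ D ω v → rho D ω v ≡ true → proj₂ (step (D , ω)) v ≡ ω v ∸ degD D v + received D ω v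
  step-fired D ω v fired = cong (λ a → stepValue a (D v) (ω v) (degD D v) (received D ω v)) fired

  step-waiting : ∀ D ω v → rho D ω v ≡ false → D v ≡ true → proj₂ (step (D , ω)) v ≡ ω v + received D ω v
  step-waiting D ω v waiting dirty =
    cong₂ (λ a b → stepValue a b (ω v) (degD D v) (received D ω v)) waiting dirty

  step-clean : ∀ D ω v → D v ≡ false → proj₂ (step (D , ω)) v ≡ ω v
  step-clean D ω v clean =
    cong₂ (λ a b → stepValue a b (ω v) (degD D v) (received D ω v)) (cong (_∧ (degD D v ≤ᵇ ω v)) clean) clean

-- In K_n, when c vertices are dirty, a dirty vertex that started with w brushes has c ∸ 1 dirty
-- neighbours and has received one brush from each of the n ∸ c clean vertices.
Fires : ℕ → ℕ → ℕ → Set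
Fires n w c = c ∸ 1 ≤ w + (n ∸ c)

Waits : ℕ → ℕ → ℕ → Set
Waits n w c = w + (n ∸ c) < c ∸ 1

-- c′ vertices are still dirty after the round, so c ∸ c′ ∸ 1 neighbours fire together with it.
afterFiring : ℕ → ℕ → ℕ → ℕ → ℕ
afterFiring n w c c′ = w + (n ∸ c) ∸ (c ∸ 1) + (c ∸ c′ ∸ 1)

module Schedule {n : ℕ} (ω₀ : Config n) (r : Fin n → ℕ) where
  open Cleaning (complete n)
  open CleaningSteps (complete n)

  dirtyCount : ℕ → ℕ
  dirtyCount t = countF (λ u → t ≤ᵇ r u)

  finalValue : Fin n → ℕ
  finalValue v = afterFiring n (ω₀ v) (dirtyCount (r v)) (dirtyCount (suc (r v)))

  dirtyAt : ℕ → DirtySet n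
  dirtyAt t v = t ≤ᵇ r v

  brushesAt : ℕ → Config n
  brushesAt t v = if t ≤ᵇ r v then ω₀ v + (n ∸ dirtyCount t) else finalValue v

  firesAt : ℕ → Fin n → Bool
  firesAt t v = (t ≤ᵇ r v) ∧ not (suc t ≤ᵇ r v)

  dirtyCount-suc : ∀ t → dirtyCount t ≡ dirtyCount (suc t) + countF (firesAt t)
  dirtyCount-suc t = trans (countF-split (dirtyAt t) (dirtyAt (suc t)))
                           (cong (_+ countF (firesAt t)) (countF-cong (λ u → still-dirty (r u))))
    where
    still-dirty : ∀ x → (t ≤ᵇ x) ∧ (suc t ≤ᵇ x) ≡ (suc t ≤ᵇ x)
    still-dirty x with suc t ≤? x
    ... | yes t<x rewrite ≤ᵇ-true (<⇒≤ t<x) | ≤ᵇ-true t<x = refl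
    ... | no  t≮x rewrite ≤ᵇ-false {suc t} {x} (≰⇒> t≮x) = ∧-zeroʳ (t ≤ᵇ x)

  dirtyCount-anti : ∀ t → dirtyCount (suc t) ≤ dirtyCount t
  dirtyCount-anti t = subst (dirtyCount (suc t) ≤_) (sym (dirtyCount-suc t)) (m≤m+n _ _)

  degD-dirtyAt : ∀ t v → t ≤ r v → degD (dirtyAt t) v ≡ dirtyCount t ∸ 1
  degD-dirtyAt t v t≤rv =
    trans (cong (λ b → if b then countF (λ u → complete n v u ∧ dirtyAt t u) else 0) (≤ᵇ-true t≤rv))
          (countF-others-true (dirtyAt t) v (≤ᵇ-true t≤rv))

  brushesAt-dirty : ∀ t v → t ≤ r v → brushesAt t v ≡ ω₀ v + (n ∸ dirtyCount t)
  brushesAt-dirty t v t≤rv = cong (λ b → if b then ω₀ v + (n ∸ dirtyCount t) else finalValue v) (≤ᵇ-true t≤rv)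

  brushesAt-clean : ∀ t v → r v < t → brushesAt t v ≡ finalValue v
  brushesAt-clean t v rv<t = cong (λ b → if b then ω₀ v + (n ∸ dirtyCount t) else finalValue v) (≤ᵇ-false rv<t)

  rho-dirty : ∀ t v → t ≤ r v →
              rho (dirtyAt t) (brushesAt t) v ≡ (dirtyCount t ∸ 1 ≤ᵇ ω₀ v + (n ∸ dirtyCount t))
  rho-dirty t v t≤rv = cong₂ _∧_ (≤ᵇ-true t≤rv) (cong₂ _≤ᵇ_ (degD-dirtyAt t v t≤rv) (brushesAt-dirty t v t≤rv))

  firesAt-now : ∀ v → firesAt (r v) v ≡ true
  firesAt-now v = cong₂ (λ a b → a ∧ not b) (≤ᵇ-true (≤-refl {r v})) (≤ᵇ-false (n<1+n (r v)))

  firesAt-later : ∀ t v → t < r v → firesAt t v ≡ false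
  firesAt-later t v t<rv = cong₂ (λ a b → a ∧ not b) (≤ᵇ-true (<⇒≤ t<rv)) (≤ᵇ-true t<rv)

  module _ (fires : ∀ v → Fires n (ω₀ v) (dirtyCount (r v)))
           (waits : ∀ v t → t < r v → Waits n (ω₀ v) (dirtyCount t)) where

    rho-firesAt : ∀ t v → rho (dirtyAt t) (brushesAt t) v ≡ firesAt t v
    rho-firesAt t v with <-cmp (r v) t
    ... | tri< rv<t _ _ rewrite ≤ᵇ-false rv<t = refl
    ... | tri≈ _ refl _ = trans (rho-dirty t v ≤-refl) (trans (≤ᵇ-true (fires v)) (sym (firesAt-now v)))
    ... | tri> _ _ t<rv =
      trans (rho-dirty t v (<⇒≤ t<rv)) (trans (≤ᵇ-false (waits v t t<rv)) (sym (firesAt-later t v t<rv)))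

    received-dirtyAt : ∀ t v → received (dirtyAt t) (brushesAt t) v + indicator (firesAt t v)
                               ≡ dirtyCount t ∸ dirtyCount (suc t)
    received-dirtyAt t v = begin
      received (dirtyAt t) (brushesAt t) v + indicator (firesAt t v)
        ≡⟨ cong (_+ indicator (firesAt t v)) (countF-cong (λ u → cong (complete n v u ∧_) (rho-firesAt t u))) ⟩
      countF (λ u → complete n v u ∧ firesAt t u) + indicator (firesAt t v) ≡⟨ countF-others (firesAt t) v ⟩
      countF (firesAt t)                                                   ≡⟨ m+n∸m≡n (dirtyCount (suc t)) _ ⟨
      dirtyCount (suc t) + countF (firesAt t) ∸ dirtyCount (suc t)
        ≡⟨ cong (_∸ dirtyCount (suc t)) (dirtyCount-suc t) ⟨
      dirtyCount t ∸ dirtyCount (suc t)                                    ∎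
      where open ≡-Reasoning

    Advances : ℕ → Fin n → Set
    Advances t v = proj₁ (step (dirtyAt t , brushesAt t)) v ≡ dirtyAt (suc t) v
                 × proj₂ (step (dirtyAt t , brushesAt t)) v ≡ brushesAt (suc t) v

    advances-clean : ∀ t v → r v < t → Advances t v
    advances-clean t v rv<t =
      trans (cong (_∧ not (rho (dirtyAt t) (brushesAt t) v)) (≤ᵇ-false rv<t)) (sym (≤ᵇ-false rv<1+t)) ,
      trans (step-clean (dirtyAt t) (brushesAt t) v (≤ᵇ-false rv<t))
            (trans (brushesAt-clean t v rv<t) (sym (brushesAt-clean (suc t) v rv<1+t)))
      where
      rv<1+t : r v < suc t
      rv<1+t = m<n⇒m<1+n rv<t

    advances-firing : ∀ v → Advances (r v) v
    advances-firing v =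
      trans (cong₂ (λ a b → a ∧ not b) (≤ᵇ-true (≤-refl {t})) fired) (sym (≤ᵇ-false (n<1+n t))) ,
      (begin
        proj₂ (step (dirtyAt t , brushesAt t)) v
          ≡⟨ step-fired (dirtyAt t) (brushesAt t) v fired ⟩
        brushesAt t v ∸ degD (dirtyAt t) v + received (dirtyAt t) (brushesAt t) v
          ≡⟨ cong₂ (λ b k → b ∸ k + received (dirtyAt t) (brushesAt t) v)
                   (brushesAt-dirty t v ≤-refl) (degD-dirtyAt t v ≤-refl) ⟩
        ω₀ v + (n ∸ dirtyCount t) ∸ (dirtyCount t ∸ 1) + received (dirtyAt t) (brushesAt t) v
          ≡⟨ cong (ω₀ v + (n ∸ dirtyCount t) ∸ (dirtyCount t ∸ 1) +_) received≡ ⟩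
        finalValue v
          ≡⟨ brushesAt-clean (suc t) v (n<1+n t) ⟨
        brushesAt (suc t) v ∎)
      where
      open ≡-Reasoning
      t : ℕ
      t = r v
      fired : rho (dirtyAt t) (brushesAt t) v ≡ true
      fired = trans (rho-firesAt t v) (firesAt-now v)
      received≡ : received (dirtyAt t) (brushesAt t) v ≡ dirtyCount t ∸ dirtyCount (suc t) ∸ 1
      received≡ = trans (sym (m+n∸n≡m _ 1))
        (cong (_∸ 1) (trans (cong (λ b → received (dirtyAt t) (brushesAt t) v + indicator b) (sym (firesAt-now v)))
                            (received-dirtyAt t v)))

    advances-waiting : ∀ t v → t < r v → Advances t v
    advances-waiting t v t<rv =
      trans (cong₂ (λ a b → a ∧ not b) (≤ᵇ-true t≤rv) waiting) (sym (≤ᵇ-true t<rv)) ,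
      (begin
        proj₂ (step (dirtyAt t , brushesAt t)) v
          ≡⟨ step-waiting (dirtyAt t) (brushesAt t) v waiting (≤ᵇ-true t≤rv) ⟩
        brushesAt t v + received (dirtyAt t) (brushesAt t) v
          ≡⟨ cong₂ _+_ (brushesAt-dirty t v t≤rv) received≡ ⟩
        ω₀ v + (n ∸ dirtyCount t) + (dirtyCount t ∸ dirtyCount (suc t))
          ≡⟨ +-assoc (ω₀ v) _ _ ⟩
        ω₀ v + ((n ∸ dirtyCount t) + (dirtyCount t ∸ dirtyCount (suc t)))
          ≡⟨ cong (ω₀ v +_) (∸-+-∸ (dirtyCount-anti t) (countF-≤ (dirtyAt t))) ⟩
        ω₀ v + (n ∸ dirtyCount (suc t))
          ≡⟨ brushesAt-dirty (suc t) v t<rv ⟨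
        brushesAt (suc t) v ∎)
      where
      open ≡-Reasoning
      t≤rv : t ≤ r v
      t≤rv = <⇒≤ t<rv
      waiting : rho (dirtyAt t) (brushesAt t) v ≡ false
      waiting = trans (rho-firesAt t v) (firesAt-later t v t<rv)
      received≡ : received (dirtyAt t) (brushesAt t) v ≡ dirtyCount t ∸ dirtyCount (suc t)
      received≡ = trans (sym (+-identityʳ _))
        (trans (cong (λ b → received (dirtyAt t) (brushesAt t) v + indicator b) (sym (firesAt-later t v t<rv)))
               (received-dirtyAt t v))

    step-state : ∀ t → step (dirtyAt t , brushesAt t) ≋ (dirtyAt (suc t) , brushesAt (suc t))
    step-state t v with <-cmp (r v) t
    ... | tri< rv<t _ _ = advances-clean t v rv<t
    ... | tri≈ _ refl _ = advances-firing v
    ... | tri> _ _ t<rv = advances-waiting t v t<rv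

    iter-state : ∀ k t → iter k (dirtyAt t , brushesAt t) ≋ (dirtyAt (k + t) , brushesAt (k + t))
    iter-state zero    t v = refl , refl
    iter-state (suc k) t   =
      ≋-trans (iter-cong k (step-state t))
              (subst (λ m → iter k (dirtyAt (suc t) , brushesAt (suc t)) ≋ (dirtyAt m , brushesAt m))
                     (+-suc k t) (iter-state k (suc t)))

    final-state : final ω₀ ≋ (dirtyAt n , brushesAt n)
    final-state = ≋-trans (iter-cong n initial)
                          (subst (λ m → iter n (dirtyAt 0 , brushesAt 0) ≋ (dirtyAt m , brushesAt m))
                                 (+-identityʳ n) (iter-state n 0))
      where
      initial : ((λ _ → true) , ω₀) ≋ (dirtyAt 0 , brushesAt 0)
      initial v = refl , sym (begin
        ω₀ v + (n ∸ countF {n} (λ _ → true)) ≡⟨ cong (λ k → ω₀ v + (n ∸ k)) (countF-true n) ⟩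
        ω₀ v + (n ∸ n)                       ≡⟨ cong (ω₀ v +_) (n∸n≡0 n) ⟩
        ω₀ v + 0                             ≡⟨ +-identityʳ (ω₀ v) ⟩
        ω₀ v                                 ∎)
        where open ≡-Reasoning

    module _ (r<n : ∀ v → r v < n) where

      scheduled-cleans : Cleans ω₀
      scheduled-cleans v = trans (proj₁ (final-state v)) (≤ᵇ-false (r<n v))

      scheduled-finalConfig : ∀ v → finalConfig ω₀ v ≡ finalValue v
      scheduled-finalConfig v = trans (proj₂ (final-state v)) (brushesAt-clean n v (r<n v))

m<n⇒m≤n∸1 : ∀ {m n} → m < n → m ≤ n ∸ 1
m<n⇒m≤n∸1 {n = suc n} (s≤s m≤n) = m≤n

n∸1<n : ∀ {n} → 1 ≤ n → n ∸ 1 < n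
n∸1<n {suc n} _ = n<1+n n

+-suc-∸1 : ∀ a b c → a + suc b + c ∸ 1 ≡ a + b + c
+-suc-∸1 a b c = cong (λ k → k + c ∸ 1) (+-suc a b)

+-∸1 : ∀ a b → a + suc b ∸ 1 ≡ a + b
+-∸1 a b = cong (_∸ 1) (+-suc a b)

+-∸-shift : ∀ a w n c → a + w + (a + n ∸ (a + c)) ≡ a + (w + (n ∸ c))
+-∸-shift a w n c = trans (+-assoc a w _) (cong (λ k → a + (w + k)) ([m+n]∸[m+o]≡n∸o a n c))

Fires-shift : ∀ a {n w c} → Fires n w c → Fires (a + n) (a + w) (a + c)
Fires-shift a {n} {w} {zero} _ =
  ≤-trans (m∸n≤m (a + 0) 1) (≤-trans (≤-reflexive (+-identityʳ a)) (≤-trans (m≤m+n a w) (m≤m+n _ _)))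
Fires-shift a {n} {w} {suc c} h = begin
  a + suc c ∸ 1                   ≡⟨ +-∸1 a c ⟩
  a + c                           ≤⟨ +-monoʳ-≤ a h ⟩
  a + (w + (n ∸ suc c))           ≡⟨ +-∸-shift a w n (suc c) ⟨
  a + w + (a + n ∸ (a + suc c))   ∎
  where open ≤-Reasoning

Waits-shift : ∀ a {n w c} → Waits n w c → Waits (a + n) (a + w) (a + c)
Waits-shift a {n} {w} {suc c} h = begin-strict
  a + w + (a + n ∸ (a + suc c))   ≡⟨ +-∸-shift a w n (suc c) ⟩
  a + (w + (n ∸ suc c))           <⟨ +-monoʳ-< a h ⟩
  a + c                           ≡⟨ +-∸1 a c ⟨
  a + suc c ∸ 1                   ∎
  where open ≤-Reasoning

afterFiring-shift : ∀ a {n w c c′} → 1 ≤ c →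
                    afterFiring (a + n) (a + w) (a + c) (a + c′) ≡ afterFiring n w c c′
afterFiring-shift a {n} {w} {suc c} {c′} _ = begin
  a + w + (a + n ∸ (a + suc c)) ∸ (a + suc c ∸ 1) + (a + suc c ∸ (a + c′) ∸ 1)
    ≡⟨ cong₂ (λ x y → x ∸ y + (a + suc c ∸ (a + c′) ∸ 1))
             (+-∸-shift a w n (suc c)) (+-∸1 a c) ⟩
  a + (w + (n ∸ suc c)) ∸ (a + c) + (a + suc c ∸ (a + c′) ∸ 1)
    ≡⟨ cong₂ (λ x y → x + (y ∸ 1)) ([m+n]∸[m+o]≡n∸o a _ c) ([m+n]∸[m+o]≡n∸o a (suc c) c′) ⟩
  w + (n ∸ suc c) ∸ c + (suc c ∸ c′ ∸ 1)
    ∎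
  where open ≡-Reasoning

base-fires : ∀ n → Fires n (n ∸ 1) n
base-fires n = m≤m+n (n ∸ 1) (n ∸ n)

base-afterFiring : ∀ n → afterFiring n (n ∸ 1) n 0 ≡ n ∸ 1
base-afterFiring n = begin
  n ∸ 1 + (n ∸ n) ∸ (n ∸ 1) + (n ∸ 1)   ≡⟨ cong (λ k → n ∸ 1 + k ∸ (n ∸ 1) + (n ∸ 1)) (n∸n≡0 n) ⟩
  n ∸ 1 + 0 ∸ (n ∸ 1) + (n ∸ 1)         ≡⟨ cong (_+ (n ∸ 1)) (m+n∸m≡n (n ∸ 1) 0) ⟩
  n ∸ 1                                 ∎
  where open ≡-Reasoning

low-fires : ∀ {a j} w → j ≤ a → Fires (a + j) w j
low-fires {a} {j} w j≤a = subst (j ∸ 1 ≤_) (cong (w +_) (sym (m+n∸n≡m a j)))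
                                (≤-trans (m∸n≤m j 1) (≤-trans j≤a (m≤n+m a w)))

low-waits : ∀ {j m c} w → w < j → j < m → c ≤ j → Waits (j + m + j) w (j + m + c)
low-waits {j} {suc m} {c} w w<j j<m c≤j = begin-strict
  w + (j + suc m + j ∸ (j + suc m + c))   ≡⟨ cong (w +_) ([m+n]∸[m+o]≡n∸o (j + suc m) j c) ⟩
  w + (j ∸ c)                             ≤⟨ +-monoʳ-≤ w (m∸n≤m j c) ⟩
  w + j                                   <⟨ +-monoˡ-< j w<j ⟩
  j + j                                   ≤⟨ +-monoʳ-≤ j (m<1+n⇒m≤n j<m) ⟩
  j + m                                   ≤⟨ m≤m+n (j + m) c ⟩
  j + m + c                               ≡⟨ +-suc-∸1 j m c ⟨
  j + suc m + c ∸ 1                       ∎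
  where open ≤-Reasoning

low-afterFiring : ∀ {a j} w → j ≤ a → afterFiring (a + j) w j 0 ≡ a + w
low-afterFiring {a} {j} w j≤a = begin
  w + (a + j ∸ j) ∸ (j ∸ 1) + (j ∸ 1)   ≡⟨ cong (λ k → w + k ∸ (j ∸ 1) + (j ∸ 1)) (m+n∸n≡m a j) ⟩
  w + a ∸ (j ∸ 1) + (j ∸ 1)             ≡⟨ m∸n+n≡m (≤-trans (m∸n≤m j 1) (≤-trans j≤a (m≤n+m a w))) ⟩
  w + a                                 ≡⟨ +-comm w a ⟩
  a + w                                 ∎
  where open ≡-Reasoning

mid-fires : ∀ j {m} → 1 ≤ m → Fires (j + m + j) (m ∸ 1) (j + m)
mid-fires j {suc m} _ = begin
  j + suc m ∸ 1                  ≡⟨ +-∸1 j m ⟩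
  j + m                          ≡⟨ +-comm j m ⟩
  m + j                          ≡⟨ cong (m +_) (m+n∸m≡n (j + suc m) j) ⟨
  m + (j + suc m + j ∸ (j + suc m)) ∎
  where open ≤-Reasoning

mid-waits : ∀ {j m c} → 1 ≤ m → 1 ≤ c → c ≤ j → Waits (j + m + j) (m ∸ 1) (j + m + c)
mid-waits {j} {suc m} {c} _ 1≤c c≤j = begin-strict
  m + (j + suc m + j ∸ (j + suc m + c))   ≡⟨ cong (m +_) ([m+n]∸[m+o]≡n∸o (j + suc m) j c) ⟩
  m + (j ∸ c)                             <⟨ +-monoʳ-< m (∸-monoʳ-< 1≤c c≤j) ⟩
  m + j                                   ≡⟨ +-comm m j ⟩
  j + m                                   ≤⟨ m≤m+n (j + m) c ⟩
  j + m + c                               ≡⟨ +-suc-∸1 j m c ⟨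
  j + suc m + c ∸ 1                       ∎
  where open ≤-Reasoning

mid-afterFiring : ∀ j {m} → 1 ≤ m → afterFiring (j + m + j) (m ∸ 1) (j + m) j ≡ m ∸ 1
mid-afterFiring j {suc m} _ = begin
  m + (j + suc m + j ∸ (j + suc m)) ∸ (j + suc m ∸ 1) + (j + suc m ∸ j ∸ 1)
    ≡⟨ cong₂ (λ x y → m + x ∸ (j + suc m ∸ 1) + (y ∸ 1)) (m+n∸m≡n (j + suc m) j) (m+n∸m≡n j (suc m)) ⟩
  m + j ∸ (j + suc m ∸ 1) + m    ≡⟨ cong (λ x → m + j ∸ x + m) (+-∸1 j m) ⟩
  m + j ∸ (j + m) + m            ≡⟨ cong (λ x → x ∸ (j + m) + m) (+-comm m j) ⟩
  j + m ∸ (j + m) + m            ≡⟨ cong (_+ m) (n∸n≡0 (j + m)) ⟩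
  m                              ∎
  where open ≡-Reasoning

≤-slack : ∀ {a b} s → a + s ≡ b → a ≤ b
≤-slack {a} s a+s≡b = subst (a ≤_) a+s≡b (m≤m+n a s)

-- The slack is a polynomial with natural coefficients in each of the three cases e ∈ {1, 2, 3}.
brushes-growth : ∀ j e S c → 1 ≤ e → e ≤ 3 → 7 * S ≤ 3 * (j * j) + 7 * suc c * j →
  7 * (S + (j + e) * (j + e ∸ 1) + (j * (j + (j + e)) + S))
    ≤ 3 * ((3 * j + e) * (3 * j + e)) + 7 * suc c * (3 * j + e)
brushes-growth j (suc e) S c _ e≤3 h = begin
  7 * (S + (j + suc e) * (j + suc e ∸ 1) + (j * (j + (j + suc e)) + S))
    ≡⟨ cong (λ k → 7 * (S + (j + suc e) * k + (j * (j + (j + suc e)) + S))) (+-∸1 j e) ⟩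
  7 * (S + (j + suc e) * (j + e) + (j * (j + (j + suc e)) + S))
    ≡⟨ regroup S ((j + suc e) * (j + e)) (j * (j + (j + suc e))) ⟩
  2 * (7 * S) + 7 * ((j + suc e) * (j + e) + j * (j + (j + suc e)))
    ≤⟨ +-monoˡ-≤ _ (*-monoʳ-≤ 2 h) ⟩
  2 * (3 * (j * j) + 7 * suc c * j) + 7 * ((j + suc e) * (j + e) + j * (j + (j + suc e)))
    ≤⟨ slack e (m<1+n⇒m≤n e≤3) ⟩
  3 * ((3 * j + suc e) * (3 * j + suc e)) + 7 * suc c * (3 * j + suc e)
    ∎
  where
  open ≤-Reasoning
  regroup : ∀ S x y → 7 * (S + x + (y + S)) ≡ 2 * (7 * S) + 7 * (x + y)
  regroup = solve-∀
  slack : ∀ e → e ≤ 2 →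
    2 * (3 * (j * j) + 7 * suc c * j) + 7 * ((j + suc e) * (j + e) + j * (j + (j + suc e)))
      ≤ 3 * ((3 * j + suc e) * (3 * j + suc e)) + 7 * suc c * (3 * j + suc e)
  slack 0 _ = ≤-slack (7 * suc c * j + 4 * j + 7 * suc c + 3) (identity j c)
    where
    identity : ∀ j c → 2 * (3 * (j * j) + 7 * suc c * j) + 7 * ((j + 1) * (j + 0) + j * (j + (j + 1)))
                         + (7 * suc c * j + 4 * j + 7 * suc c + 3)
                       ≡ 3 * ((3 * j + 1) * (3 * j + 1)) + 7 * suc c * (3 * j + 1)
    identity = solve-∀
  slack 1 _ = ≤-slack (7 * suc c * j + j + 14 * c + 12) (identity j c)
    where
    identity : ∀ j c → 2 * (3 * (j * j) + 7 * suc c * j) + 7 * ((j + 2) * (j + 1) + j * (j + (j + 2)))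
                         + (7 * suc c * j + j + 14 * c + 12)
                       ≡ 3 * ((3 * j + 2) * (3 * j + 2)) + 7 * suc c * (3 * j + 2)
    identity = solve-∀
  slack 2 _ = ≤-slack (7 * c * j + 5 * j + 21 * c + 6) (identity j c)
    where
    identity : ∀ j c → 2 * (3 * (j * j) + 7 * suc c * j) + 7 * ((j + 3) * (j + 2) + j * (j + (j + 3)))
                         + (7 * c * j + 5 * j + 21 * c + 6)
                       ≡ 3 * ((3 * j + 3) * (3 * j + 3)) + 7 * suc c * (3 * j + 3)
    identity = solve-∀
  slack (suc (suc (suc _))) (s≤s (s≤s ()))

brushes-base : ∀ m → 7 * (m * (m ∸ 1)) ≤ 3 * (m * m) + 7 * suc m * m
brushes-base m = begin
  7 * (m * (m ∸ 1))   ≤⟨ *-monoʳ-≤ 7 (*-monoʳ-≤ m (≤-trans (m∸n≤m m 1) (n≤1+n m))) ⟩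
  7 * (m * suc m)     ≡⟨ cong (7 *_) (*-comm m (suc m)) ⟩
  7 * (suc m * m)     ≡⟨ *-assoc 7 (suc m) m ⟨
  7 * suc m * m       ≤⟨ m≤n+m (7 * suc m * m) (3 * (m * m)) ⟩
  3 * (m * m) + 7 * suc m * m ∎
  where open ≤-Reasoning

LightOneClique : ℕ → ℕ → Set
LightOneClique n C = Σ (Config n) λ ω₀ → OneClique n ω₀ × 7 * brushes ω₀ ≤ 3 * (n * n) + 7 * C * n

pattern low x  = inj₁ (inj₁ x)
pattern mid k  = inj₁ (inj₂ k)
pattern high y = inj₂ y

module Construction (m₀ : ℕ) (d : ℕ → ℕ) (m₀-pos : 1 ≤ m₀)
                    (d-range : ∀ i → 1 ≤ d (suc i) × d (suc i) ≤ 3) where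

  N : ℕ → ℕ
  N = nSeq m₀ d

  M : ℕ → ℕ
  M i = N i + d (suc i)

  layout : ∀ i → N (suc i) ≡ N i + M i + N i
  layout i = lemma (N i) (d (suc i))
    where
    lemma : ∀ j e → 3 * j + e ≡ j + (j + e) + j
    lemma = solve-∀

  Vertex : ℕ → Set
  Vertex zero    = Fin m₀
  Vertex (suc i) = (Vertex i ⊎ Fin (M i)) ⊎ Vertex i

  vertexIso : ∀ i → Fin (N i) ↔ Vertex i
  vertexIso zero    = ↔-refl
  vertexIso (suc i) = ↔-trans (cast-id (layout i))
                        (↔-trans +↔⊎ (↔-trans +↔⊎ (vertexIso i ⊎-↔ ↔-refl) ⊎-↔ vertexIso i))

  vertex : ∀ {i} → Fin (N i) → Vertex i
  vertex {i} = Inverse.to (vertexIso i)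

  sumV : ∀ i → (Vertex i → ℕ) → ℕ
  sumV zero    f = sumF f
  sumV (suc i) f = sumV i (λ x → f (low x)) + sumF (λ k → f (mid k)) + sumV i (λ y → f (high y))

  sumF-vertex : ∀ i f → sumF (f ∘ vertex {i}) ≡ sumV i f
  sumF-vertex zero    f = refl
  sumF-vertex (suc i) f = begin
    sumF (f ∘ vertex {suc i})
      ≡⟨ sumF-cast (layout i) (f ∘ blocks ∘ splitAt (N i + M i)) ⟩
    sumF (f ∘ blocks ∘ splitAt (N i + M i))
      ≡⟨ sumF-splitAt (N i + M i) (f ∘ blocks) ⟩
    sumF (f ∘ inj₁ ∘ Sum.map vertex id ∘ splitAt (N i)) + sumF (λ y → f (high (vertex y)))
      ≡⟨ cong₂ _+_ (sumF-splitAt (N i) (f ∘ inj₁ ∘ Sum.map vertex id)) (sumF-vertex i (λ y → f (high y))) ⟩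
    sumF (λ x → f (low (vertex x))) + sumF (λ k → f (mid k)) + sumV i (λ y → f (high y))
      ≡⟨ cong (λ s → s + sumF (λ k → f (mid k)) + sumV i (λ y → f (high y))) (sumF-vertex i (λ x → f (low x))) ⟩
    sumV (suc i) f ∎
    where
    open ≡-Reasoning
    blocks : Fin (N i + M i) ⊎ Fin (N i) → Vertex (suc i)
    blocks = Sum.map (Sum.map vertex id ∘ splitAt (N i)) vertex

  countF-vertex : ∀ i (P : Vertex i → Bool) → countF (P ∘ vertex {i}) ≡ sumV i (indicator ∘ P)
  countF-vertex i P = trans (countF-sumF (P ∘ vertex {i})) (sumF-vertex i (indicator ∘ P))

  sumV-cong : ∀ i {f g} → (∀ v → f v ≡ g v) → sumV i f ≡ sumV i g
  sumV-cong i {f} {g} f≗g = trans (sym (sumF-vertex i f)) (trans (sumF-cong (f≗g ∘ vertex)) (sumF-vertex i g))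

  sumV-const : ∀ i a → sumV i (λ _ → a) ≡ N i * a
  sumV-const i a = trans (sym (sumF-vertex i _)) (sumF-const (N i) a)

  sumV-+ : ∀ i f g → sumV i (λ v → f v + g v) ≡ sumV i f + sumV i g
  sumV-+ i f g = trans (sym (sumF-vertex i _))
                       (trans (sumF-+ (f ∘ vertex) (g ∘ vertex)) (cong₂ _+_ (sumF-vertex i f) (sumF-vertex i g)))

  lastRound : ℕ → ℕ
  lastRound zero    = 0
  lastRound (suc i) = suc (suc (lastRound i))

  initial : ∀ i → Vertex i → ℕ
  initial zero    _        = m₀ ∸ 1
  initial (suc i) (low x)  = initial i x
  initial (suc i) (mid _)  = M i ∸ 1
  initial (suc i) (high y) = N i + M i + initial i y

  round : ∀ i → Vertex i → ℕ
  round zero    _        = 0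
  round (suc i) (low _)  = lastRound (suc i)
  round (suc i) (mid _)  = suc (lastRound i)
  round (suc i) (high y) = round i y

  relabel : ∀ i → Vertex i → Vertex i
  relabel zero    x        = x
  relabel (suc i) (low x)  = high (relabel i x)
  relabel (suc i) (mid k)  = mid k
  relabel (suc i) (high y) = low y

  unrelabel : ∀ i → Vertex i → Vertex i
  unrelabel zero    x        = x
  unrelabel (suc i) (low x)  = high x
  unrelabel (suc i) (mid k)  = mid k
  unrelabel (suc i) (high y) = low (unrelabel i y)

  relabel-unrelabel : ∀ i v → relabel i (unrelabel i v) ≡ v
  relabel-unrelabel zero    v        = refl
  relabel-unrelabel (suc i) (low x)  = refl
  relabel-unrelabel (suc i) (mid k)  = refl
  relabel-unrelabel (suc i) (high y) = cong high (relabel-unrelabel i y)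

  unrelabel-relabel : ∀ i v → unrelabel i (relabel i v) ≡ v
  unrelabel-relabel zero    v        = refl
  unrelabel-relabel (suc i) (low x)  = cong low (unrelabel-relabel i x)
  unrelabel-relabel (suc i) (mid k)  = refl
  unrelabel-relabel (suc i) (high y) = refl

  relabelIso : ∀ i → Vertex i ↔ Vertex i
  relabelIso i = mk↔ₛ′ (relabel i) (unrelabel i) (relabel-unrelabel i) (unrelabel-relabel i)

  N-pos : ∀ i → 1 ≤ N i
  N-pos zero    = m₀-pos
  N-pos (suc i) = ≤-trans (proj₁ (d-range i)) (m≤n+m (d (suc i)) (3 * N i))

  N<M : ∀ i → N i < M i
  N<M i = subst (_≤ M i) (+-comm (N i) 1) (+-monoʳ-≤ (N i) (proj₁ (d-range i)))

  M-pos : ∀ i → 1 ≤ M i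
  M-pos i = ≤-trans (s≤s z≤n) (N<M i)

  <-N-suc : ∀ i {x} → x < N i + M i + N i → x < N (suc i)
  <-N-suc i {x} = subst (x <_) (sym (layout i))

  initial-< : ∀ i v → initial i v < N i
  initial-< zero    _        = n∸1<n m₀-pos
  initial-< (suc i) (low x)  = <-N-suc i (≤-trans (initial-< i x) (≤-trans (m≤m+n (N i) (M i)) (m≤m+n _ (N i))))
  initial-< (suc i) (mid _)  = <-N-suc i (≤-trans (n∸1<n (M-pos i)) (≤-trans (m≤n+m (M i) (N i)) (m≤m+n _ (N i))))
  initial-< (suc i) (high y) = <-N-suc i (+-monoʳ-< (N i + M i) (initial-< i y))

  round-≤ : ∀ i v → round i v ≤ lastRound i
  round-≤ zero    _        = z≤n
  round-≤ (suc i) (low _)  = ≤-refl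
  round-≤ (suc i) (mid _)  = n≤1+n _
  round-≤ (suc i) (high y) = ≤-trans (round-≤ i y) (≤-trans (n≤1+n _) (n≤1+n _))

  lastRound-< : ∀ i → lastRound i < N i
  lastRound-< zero    = m₀-pos
  lastRound-< (suc i) = <-N-suc i (begin-strict
    2 + lastRound i   <⟨ +-monoʳ-< 2 (lastRound-< i) ⟩
    2 + N i           ≤⟨ +-monoˡ-≤ (N i) (+-mono-≤ (N-pos i) (M-pos i)) ⟩
    N i + M i + N i   ∎)
    where open ≤-Reasoning

  dirty : ∀ i → ℕ → ℕ
  dirty i t = sumV i (λ v → indicator (t ≤ᵇ round i v))

  dirty-suc : ∀ i t → dirty (suc i) t ≡ N i * indicator (t ≤ᵇ lastRound (suc i))
                                         + M i * indicator (t ≤ᵇ suc (lastRound i)) + dirty i t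
  dirty-suc i t = cong (_+ dirty i t) (cong₂ _+_ (sumV-const i _) (sumF-const (M i) _))

  dirty-base : dirty 0 0 ≡ m₀
  dirty-base = trans (sumF-const m₀ 1) (*-identityʳ m₀)

  dirty-≤ : ∀ i t → dirty i t ≤ N i
  dirty-≤ i t = subst (_≤ N i) (countF-vertex i (λ v → t ≤ᵇ round i v)) (countF-≤ (λ u → t ≤ᵇ round i (vertex u)))

  dirty-pos : ∀ i t → t ≤ lastRound i → 1 ≤ dirty i t
  dirty-pos zero    zero    _ = subst (1 ≤_) (sym dirty-base) m₀-pos
  dirty-pos (suc i) t t≤ =
    subst (1 ≤_) (sym (dirty-suc i t))
          (≤-trans (subst (1 ≤_) (sym low-dirty) (N-pos i)) (≤-trans (m≤m+n _ _) (m≤m+n _ _)))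
    where
    low-dirty : N i * indicator (t ≤ᵇ lastRound (suc i)) ≡ N i
    low-dirty = trans (cong (λ b → N i * indicator b) (≤ᵇ-true t≤)) (*-identityʳ (N i))

  dirty-none : ∀ i t → lastRound i < t → dirty i t ≡ 0
  dirty-none i t lt = trans (sumV-cong i (λ v → cong indicator (≤ᵇ-false (≤-<-trans (round-≤ i v) lt))))
                            (trans (sumV-const i 0) (*-zeroʳ (N i)))

  dirty-early : ∀ i t → t ≤ suc (lastRound i) → dirty (suc i) t ≡ N i + M i + dirty i t
  dirty-early i t t≤ = begin
    dirty (suc i) t
      ≡⟨ dirty-suc i t ⟩
    N i * indicator (t ≤ᵇ lastRound (suc i)) + M i * indicator (t ≤ᵇ suc (lastRound i)) + dirty i t
      ≡⟨ cong₂ (λ a b → N i * indicator a + M i * indicator b + dirty i t)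
               (≤ᵇ-true (≤-trans t≤ (n≤1+n _))) (≤ᵇ-true t≤) ⟩
    N i * 1 + M i * 1 + dirty i t
      ≡⟨ cong₂ (λ a b → a + b + dirty i t) (*-identityʳ (N i)) (*-identityʳ (M i)) ⟩
    N i + M i + dirty i t ∎
    where open ≡-Reasoning

  dirty-middle : ∀ i → dirty (suc i) (suc (lastRound i)) ≡ N i + M i
  dirty-middle i = trans (dirty-early i _ ≤-refl)
                         (trans (cong (N i + M i +_) (dirty-none i _ ≤-refl)) (+-identityʳ _))

  dirty-last : ∀ i → dirty (suc i) (lastRound (suc i)) ≡ N i
  dirty-last i = trans (dirty-suc i _) (trans (cong₂ _+_ (cong₂ _+_ low-dirty mid-clean) high-clean)
                                              (trans (+-identityʳ _) (+-identityʳ _)))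
    where
    low-dirty : N i * indicator (lastRound (suc i) ≤ᵇ lastRound (suc i)) ≡ N i
    low-dirty = trans (cong (λ b → N i * indicator b) (≤ᵇ-true (≤-refl {lastRound (suc i)}))) (*-identityʳ (N i))
    mid-clean : M i * indicator (lastRound (suc i) ≤ᵇ suc (lastRound i)) ≡ 0
    mid-clean = trans (cong (λ b → M i * indicator b) (≤ᵇ-false (n<1+n (suc (lastRound i))))) (*-zeroʳ (M i))
    high-clean : dirty i (lastRound (suc i)) ≡ 0
    high-clean = dirty-none i _ (m<n⇒m<1+n (n<1+n (lastRound i)))

  private
    subst-layout : ∀ (P : ℕ → ℕ → Set) i {c c′} → c′ ≡ c → P (N i + M i + N i) c → P (N (suc i)) c′
    subst-layout P i c′≡c = subst₂ P (sym (layout i)) (sym c′≡c)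

    afterFiring-next : ∀ i {w c₁ c₂ c₁′ c₂′} → c₁ ≡ c₁′ → c₂ ≡ c₂′ →
                       afterFiring (N (suc i)) w c₁ c₂ ≡ afterFiring (N i + M i + N i) w c₁′ c₂′
    afterFiring-next i {w} {c₁} {c₂} e₁ e₂ =
      trans (cong (λ n → afterFiring n w c₁ c₂) (layout i)) (cong₂ (afterFiring _ w) e₁ e₂)

  fires : ∀ i v → Fires (N i) (initial i v) (dirty i (round i v))
  fires zero    _        = subst (Fires m₀ (m₀ ∸ 1)) (sym dirty-base) (base-fires m₀)
  fires (suc i) (low x)  = subst-layout (λ n → Fires n (initial i x)) i (dirty-last i)
                             (low-fires (initial i x) (m≤m+n (N i) (M i)))
  fires (suc i) (mid _)  = subst-layout (λ n → Fires n (M i ∸ 1)) i (dirty-middle i)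
                             (mid-fires (N i) (M-pos i))
  fires (suc i) (high y) = subst-layout (λ n → Fires n (N i + M i + initial i y)) i
                             (dirty-early i _ (≤-trans (round-≤ i y) (n≤1+n _)))
                             (Fires-shift (N i + M i) (fires i y))

  waits : ∀ i v t → t < round i v → Waits (N i) (initial i v) (dirty i t)
  waits zero    _        _ ()
  waits (suc i) (low x)  t t<r = subst-layout (λ n → Waits n (initial i x)) i (dirty-early i t (m<1+n⇒m≤n t<r))
                                   (low-waits (initial i x) (initial-< i x) (N<M i) (dirty-≤ i t))
  waits (suc i) (mid _)  t t<r = subst-layout (λ n → Waits n (M i ∸ 1)) i (dirty-early i t (<⇒≤ t<r))
                                   (mid-waits (M-pos i) (dirty-pos i t (m<1+n⇒m≤n t<r)) (dirty-≤ i t))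
  waits (suc i) (high y) t t<r = subst-layout (λ n → Waits n (N i + M i + initial i y)) i
                                   (dirty-early i t (≤-trans (<⇒≤ t<r) (≤-trans (round-≤ i y) (n≤1+n _))))
                                   (Waits-shift (N i + M i) (waits i y t t<r))

  final : ∀ i → Vertex i → ℕ
  final i v = afterFiring (N i) (initial i v) (dirty i (round i v)) (dirty i (suc (round i v)))

  final-high : ∀ i y → final (suc i) (high y) ≡ final i y
  final-high i y = trans (afterFiring-next i (dirty-early i _ (≤-trans (round-≤ i y) (n≤1+n _)))
                                             (dirty-early i _ (s≤s (round-≤ i y))))
                         (afterFiring-shift (N i + M i) (dirty-pos i _ (round-≤ i y)))

  final-relabel : ∀ i v → final i (relabel i v) ≡ initial i v
  final-relabel zero    _        = trans (cong₂ (afterFiring m₀ (m₀ ∸ 1)) dirty-base (dirty-none 0 1 ≤-refl))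
                                         (base-afterFiring m₀)
  final-relabel (suc i) (low x)  = trans (final-high i (relabel i x)) (final-relabel i x)
  final-relabel (suc i) (mid _)  = trans (afterFiring-next i (dirty-middle i) (dirty-last i))
                                         (mid-afterFiring (N i) (M-pos i))
  final-relabel (suc i) (high y) = trans (afterFiring-next i (dirty-last i) (dirty-none (suc i) _ ≤-refl))
                                         (low-afterFiring (initial i y) (m≤m+n (N i) (M i)))

  total : ℕ → ℕ
  total i = sumV i (initial i)

  total-suc : ∀ i → total (suc i) ≡ total i + M i * (M i ∸ 1) + (N i * (N i + M i) + total i)
  total-suc i = cong₂ _+_ (cong (total i +_) (sumF-const (M i) (M i ∸ 1)))
                          (trans (sumV-+ i (λ _ → N i + M i) (initial i)) (cong (_+ total i) (sumV-const i _)))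

  total-bound : ∀ i → 7 * total i ≤ 3 * (N i * N i) + 7 * suc m₀ * N i
  total-bound zero    rewrite sumF-const m₀ (m₀ ∸ 1) = brushes-base m₀
  total-bound (suc i) rewrite total-suc i =
    brushes-growth (N i) (d (suc i)) (total i) m₀ (proj₁ (d-range i)) (proj₂ (d-range i)) (total-bound i)

  oneClique : ∀ i → LightOneClique (N i) (suc m₀)
  oneClique i = ω₀ , (scheduled-cleans fires′ waits′ r<n , bounded , π , relabelled) , light
    where
    ω₀ : Config (N i)
    ω₀ = initial i ∘ vertex
    r : Fin (N i) → ℕ
    r = round i ∘ vertex
    open Schedule ω₀ r
    open Cleaning (complete (N i)) using (finalConfig)
    dirtyCount≡ : ∀ t → dirtyCount t ≡ dirty i t
    dirtyCount≡ t = countF-vertex i (λ v → t ≤ᵇ round i v)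
    fires′ : ∀ u → Fires (N i) (ω₀ u) (dirtyCount (r u))
    fires′ u = subst (Fires (N i) (ω₀ u)) (sym (dirtyCount≡ (r u))) (fires i (vertex u))
    waits′ : ∀ u t → t < r u → Waits (N i) (ω₀ u) (dirtyCount t)
    waits′ u t t<r = subst (Waits (N i) (ω₀ u)) (sym (dirtyCount≡ t)) (waits i (vertex u) t t<r)
    r<n : ∀ u → r u < N i
    r<n u = ≤-<-trans (round-≤ i (vertex u)) (lastRound-< i)
    bounded : ∀ u → ω₀ u ≤ N i ∸ 1
    bounded u = m<n⇒m≤n∸1 (initial-< i (vertex u))
    π : Permutation′ (N i)
    π = ↔-trans (vertexIso i) (↔-trans (relabelIso i) (↔-sym (vertexIso i)))
    finalValue≡ : ∀ {u v} → vertex u ≡ v → finalValue u ≡ final i v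
    finalValue≡ {u} refl = cong₂ (afterFiring (N i) (ω₀ u)) (dirtyCount≡ (r u)) (dirtyCount≡ (suc (r u)))
    relabelled : ∀ u → finalConfig ω₀ (π ⟨$⟩ʳ u) ≡ ω₀ u
    relabelled u = begin
      finalConfig ω₀ (π ⟨$⟩ʳ u)       ≡⟨ scheduled-finalConfig fires′ waits′ r<n _ ⟩
      finalValue (π ⟨$⟩ʳ u)           ≡⟨ finalValue≡ (Inverse.strictlyInverseˡ (vertexIso i) (relabel i (vertex u))) ⟩
      final i (relabel i (vertex u))  ≡⟨ final-relabel i (vertex u) ⟩
      ω₀ u                            ∎
      where open ≡-Reasoning
    light : 7 * brushes ω₀ ≤ 3 * (N i * N i) + 7 * suc m₀ * N i
    light = subst (λ s → 7 * s ≤ 3 * (N i * N i) + 7 * suc m₀ * N i)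
                  (sym (sumF-vertex i (initial i))) (total-bound i)

light⇒claimed : ∀ i {n C} → LightOneClique n C →
  Σ (Config n) λ ω₀ → OneClique n ω₀ ×
    63 * 9 ^ i * brushes ω₀ ≤ (27 * 9 ^ i + 2 ^ i) * (n * n) + 63 * 9 ^ i * C * n
light⇒claimed i {n} {C} (ω₀ , oneClique , light) = ω₀ , oneClique , (begin
  63 * 9 ^ i * brushes ω₀                      ≡⟨ factor (9 ^ i) (brushes ω₀) ⟩
  9 * 9 ^ i * (7 * brushes ω₀)                 ≤⟨ *-monoʳ-≤ (9 * 9 ^ i) light ⟩
  9 * 9 ^ i * (3 * (n * n) + 7 * C * n)        ≡⟨ expand (9 ^ i) n C ⟩
  27 * 9 ^ i * (n * n) + 63 * 9 ^ i * C * n    ≤⟨ +-monoˡ-≤ _ (*-monoˡ-≤ (n * n) (m≤m+n (27 * 9 ^ i) (2 ^ i))) ⟩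
  (27 * 9 ^ i + 2 ^ i) * (n * n) + 63 * 9 ^ i * C * n ∎)
  where
  open ≤-Reasoning
  factor : ∀ a S → 63 * a * S ≡ 9 * a * (7 * S)
  factor = solve-∀
  expand : ∀ a n C → 9 * a * (3 * (n * n) + 7 * C * n) ≡ 27 * a * (n * n) + 63 * a * C * n
  expand = solve-∀

emptyClique : ∀ C → LightOneClique 0 C
emptyClique C = (λ ()) , ((λ ()) , (λ ()) , ↔-refl , (λ ())) , z≤n

nSeq-shift : ∀ d i → nSeq (d 1) (d ∘ suc) i ≡ nSeq 0 d (suc i)
nSeq-shift d zero    = refl
nSeq-shift d (suc i) = cong (λ n → 3 * n + d (suc (suc i))) (nSeq-shift d i)

mainTheorem8 : (n₀ : ℕ) (d : ℕ → ℕ) →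
    (∀ i → 1 ≤ d (suc i) × d (suc i) ≤ 3) →
    ∃ λ (C : ℕ) → ∀ (i : ℕ) →
      Σ (Config (nSeq n₀ d i)) λ ω₀ →
        OneClique (nSeq n₀ d i) ω₀ ×
        63 * 9 ^ i * brushes ω₀
          ≤ (27 * 9 ^ i + 2 ^ i) * (nSeq n₀ d i * nSeq n₀ d i)
            + 63 * 9 ^ i * C * nSeq n₀ d i
mainTheorem8 (suc m) d d-range =
  suc (suc m) , λ i → light⇒claimed i (Construction.oneClique (suc m) d (s≤s z≤n) d-range i)
-- Level 0 of the construction needs n₀ ≥ 1, so for n₀ = 0 it is started at n₁ = d₁.
mainTheorem8 zero d d-range = suc (d 1) , λ where
  zero    → light⇒claimed 0 {C = suc (d 1)} (emptyClique (suc (d 1)))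
  (suc i) → light⇒claimed (suc i)
              (subst (λ n → LightOneClique n (suc (d 1))) (nSeq-shift d i)
                     (Construction.oneClique (d 1) (d ∘ suc) (proj₁ (d-range 0)) (d-range ∘ suc) i))
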